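{- Let $n\ge2$ be an integer and suppose $a_1,a_2,a_3,a_4$ are integers in $\left[\frac{n}{\log n},n\right]$ such that for each $i$, $d^2\mid a_i$ (with $d$ a positive integer) implies $d\le\log n$. If $a_1a_2a_3a_4$ is a perfect cube, then for each $i$ there exist integers $u_i,v_i,w_i\in\left(\frac{\sqrt[3]n}{(\log n)^{16}},\sqrt[3]n(\log n)^{16}\right)$ such that $a_i=u_iv_iw_i$.
   Context: $\log$ denotes the natural logarithm. -}

module Defs where

open import Data.Nat as ℕ using (ℕ; zero; suc)
open import Data.Integer as ℤ using (ℤ; +_)
open import Data.Rational using (ℚ; 0ℚ; 1ℚ; _+_; _*_; _/_; _≤_; _<_)
open import Data.Product using (Σ; ∃; _×_; _,_)
open import Relation.Binary.PropositionalEquality using (_≡_)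

ℕtoℚ : ℕ → ℚ
ℕtoℚ n = + n / 1

ℤtoℚ : ℤ → ℚ
ℤtoℚ z = z / 1

_^ℚ_ : ℚ → ℕ → ℚ
q ^ℚ zero = 1ℚ
q ^ℚ suc k = (q ^ℚ k) * q

expTerm : ℚ → ℕ → ℚ
expTerm q zero = 1ℚ
expTerm q (suc k) = (expTerm q k * q) * (+ 1 / suc k)

expPartial : ℚ → ℕ → ℚ
expPartial q zero = 0ℚ
expPartial q (suc N) = expPartial q N + expTerm q N

-- For q ≥ 0:  ExpLe q r  ⟺  e^q ≤ r  (e^q is the supremum of the partial sums).
ExpLe : ℚ → ℚ → Set
ExpLe q r = ∀ N → expPartial q N ≤ r

-- For q ≥ 0 and n ≥ 1:  q ≤ log n  ⟺  e^q ≤ n.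
LeLog : ℚ → ℕ → Set
LeLog q n = ExpLe q (ℕtoℚ n)

-- For q ≥ 0 and n ≥ 1:  q < log n  ⟺  e^q < n  ⟺  ∃ rational r < n with e^q ≤ r.
LtLog : ℚ → ℕ → Set
LtLog q n = ∃ λ r → r < ℕtoℚ n × ExpLe q r

-- n / log n ≤ a  (n ≥ 2, so log n > 0).  This forces a > 0, and then it is
-- equivalent to  n / a ≤ log n.
NOverLogLe : ℕ → ℤ → Set
NOverLogLe n a = Σ ℕ λ k → (a ≡ + suc k) × LeLog (+ n / suc k) n

-- n^{1/3} / (log n)^16 < u < n^{1/3} (log n)^16   (n ≥ 2).
-- Lower bound: forces u > 0, and then ⟺ n < u^3 (log n)^48
--   ⟺ ∃ rational q > 0 with n < u^3 q^48 and q < log n.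
-- Upper bound (given u > 0): u^3 < n (log n)^48
--   ⟺ ∃ rational q > 0 with u^3 < n q^48 and q < log n.
InWindow : ℕ → ℤ → Set
InWindow n u =
    (0ℚ < ℤtoℚ u)
  × (∃ λ q → 0ℚ < q × ℕtoℚ n < (ℤtoℚ u ^ℚ 3) * (q ^ℚ 48) × LtLog q n)
  × (∃ λ q → 0ℚ < q × (ℤtoℚ u ^ℚ 3) < ℕtoℚ n * (q ^ℚ 48) × LtLog q n)

{-# OPTIONS --safe #-}

-- Let Dᵢ be maximal with Dᵢ² ∣ aᵢ, so that aᵢ/Dᵢ² is squarefree and Dᵢ ≤ log n, and put
-- g = (a₁,a₂), w = (g,a₃), u = a₁/g, v = g/w, so that a₁ = uvw. Prime by prime, ν_p(u³a₂²) and
-- ν_p(a₁a₃a₄) differ by at most 8∑ᵢ ν_p(Dᵢ): they agree when p divides no Dᵢ, because then every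
-- exponent is at most 1 and 3 ∣ ∑ᵢ ν_p(aᵢ) leaves only balanced patterns, and a crude bound suffices
-- otherwise. Hence u³a₂² and a₁a₃a₄ agree up to the factor (D₁D₂D₃D₄)⁸, and likewise v³a₃² and
-- a₁a₂a₄, w³a₄² and a₁a₂a₃. With M = max(21/20, n/aᵢ, Dᵢ) ≤ log n and n/M ≤ aᵢ ≤ n this gives
-- n ≤ u³M³⁵ and u³ ≤ nM³⁵. Finally M³⁵ < (θM)⁴⁸ for θ = 99/100, and θM < log n by convexity of exp.
-- For n = 2 there is nothing to prove: no integer lies in [2/log 2, 2].
module Submission where

module PrimeValuation where

  open import Data.Nat
  open import Data.Nat.Properties
  open import Data.Nat.Divisibility
  open import Data.Nat.GCD using (gcd; gcd[m,n]∣m; gcd[m,n]∣n; gcd-greatest; gcd[m,n]≢0)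
  open import Data.Nat.Induction using (<-rec)
  open import Data.Nat.Primality
  open import Data.Nat.Primality.Factorisation using (factorise)
  open import Data.List using ([]; _∷_)
  open import Data.List.Relation.Unary.All using (_∷_)
  open import Data.Nat.ListAction using (product)
  open import Data.Product using (∃; _×_; _,_)
  open import Data.Sum using (inj₁; inj₂; [_,_]′)
  open import Data.Empty using (⊥-elim)
  open import Relation.Nullary using (¬_; yes; no)
  open import Relation.Binary.PropositionalEquality
  open import Function.Base using (_∘_; it)
  open import Data.Nat.Tactic.RingSolver using (solve-∀)

  gcd-nonZero : ∀ m n .{{_ : NonZero m}} → NonZero (gcd m n)
  gcd-nonZero m n = ≢-nonZero (gcd[m,n]≢0 m n (inj₁ (≢-nonZero⁻¹ m)))

  prime⇒2≤ : ∀ {p} → Prime p → 2 ≤ p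
  prime⇒2≤ {p} (prime {{nt}} _) = nonTrivial⇒n>1 p

  prime-divisor : ∀ x → 2 ≤ x → ∃ λ p → Prime p × p ∣ x
  prime-divisor (suc zero) (s≤s ())
  prime-divisor x@(suc (suc _)) _ with factorise x
  ... | record { factors = [] ; isFactorisation = () }
  ... | record { factors = p ∷ ps ; isFactorisation = eq ; factorsPrime = pp ∷ _ } =
    p , pp , divides (product ps) (trans eq (*-comm p (product ps)))

  module _ {p : ℕ} (pp : Prime p) where

    private instance
      p≢0 : NonZero p
      p≢0 = prime⇒nonZero pp

    record PowerSplit (x : ℕ) : Set where
      constructor split
      field
        exponent cofactor : ℕ
        x≡ : x ≡ p ^ exponent * cofactor
        p∤cofactor : ¬ p ∣ cofactor

    powerSplit : ∀ x .{{_ : NonZero x}} → PowerSplit x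
    powerSplit x = <-rec (λ x → .{{_ : NonZero x}} → PowerSplit x) step x
      where
      step : ∀ x → (∀ {y} → y < x → .{{_ : NonZero y}} → PowerSplit y) → .{{_ : NonZero x}} → PowerSplit x
      step x rec with p ∣? x
      ... | no p∤x = split 0 x (sym (+-identityʳ x)) p∤x
      ... | yes (divides zero x≡0) = ⊥-elim (≢-nonZero⁻¹ x x≡0)
      ... | yes (divides q@(suc _) x≡qp) with rec (subst (q <_) (sym x≡qp) (m<m*n q p (prime⇒2≤ pp)))
      ...   | split e r q≡ p∤r = split (suc e) r x≡ p∤r
        where
        x≡ : x ≡ p ^ suc e * r
        x≡ = trans x≡qp (trans (cong (_* p) q≡) (reassoc (p ^ e) r p))
          where
          reassoc : ∀ a r p → a * r * p ≡ p * a * r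
          reassoc = solve-∀

    ν : ℕ → ℕ
    ν zero = 0
    ν x@(suc _) = PowerSplit.exponent (powerSplit x)

    ν-spec : ∀ x .{{_ : NonZero x}} → ∃ λ r → x ≡ p ^ ν x * r × ¬ p ∣ r
    ν-spec (suc x) = let split _ r x≡ p∤r = powerSplit (suc x) in r , x≡ , p∤r

    private
      p∣p^[1+e]*r : ∀ e r → p ∣ p ^ suc e * r
      p∣p^[1+e]*r e r = subst (p ∣_) (sym (*-assoc p (p ^ e) r)) (m∣m*n (p ^ e * r))

      ^-monoʳ-∣ : ∀ {k e} → k ≤ e → p ^ k ∣ p ^ e
      ^-monoʳ-∣ {k} {e} k≤e =
        subst (p ^ k ∣_) (trans (sym (^-distribˡ-+-* p k (e ∸ k))) (cong (p ^_) (m+[n∸m]≡n k≤e))) (m∣m*n _)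

      exponents-unique : ∀ e f r s → p ^ e * r ≡ p ^ f * s → ¬ p ∣ r → ¬ p ∣ s → e ≡ f
      exponents-unique zero zero r s _ _ _ = refl
      exponents-unique zero (suc f) r s eq p∤r _ =
        ⊥-elim (p∤r (subst (p ∣_) (trans (sym eq) (+-identityʳ r)) (p∣p^[1+e]*r f s)))
      exponents-unique (suc e) zero r s eq _ p∤s =
        ⊥-elim (p∤s (subst (p ∣_) (trans eq (+-identityʳ s)) (p∣p^[1+e]*r e r)))
      exponents-unique (suc e) (suc f) r s eq p∤r p∤s = cong suc (exponents-unique e f r s
        (*-cancelˡ-≡ _ _ p (trans (sym (*-assoc p (p ^ e) r)) (trans eq (*-assoc p (p ^ f) s)))) p∤r p∤s)

    ν-unique : ∀ {x} e r → x ≡ p ^ e * r → ¬ p ∣ r → ν x ≡ e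
    ν-unique {zero} e r 0≡ p∤r with m*n≡0⇒m≡0∨n≡0 (p ^ e) (sym 0≡)
    ... | inj₁ p^e≡0 = ⊥-elim (≢-nonZero⁻¹ (p ^ e) {{m^n≢0 p e}} p^e≡0)
    ... | inj₂ refl = ⊥-elim (p∤r (p ∣0))
    ν-unique {x@(suc _)} e r x≡ p∤r =
      let r′ , x≡′ , p∤r′ = ν-spec x in exponents-unique _ e r′ r (trans (sym x≡′) x≡) p∤r′ p∤r

    ν-≡0 : ∀ {x} → ¬ p ∣ x → ν x ≡ 0
    ν-≡0 {x} p∤x = ν-unique 0 x (sym (+-identityʳ x)) p∤x

    p∤1 : ¬ p ∣ 1
    p∤1 p∣1 = <⇒≱ (prime⇒2≤ pp) (∣⇒≤ p∣1)

    ν-self : ν p ≡ 1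
    ν-self = ν-unique 1 1 (sym (trans (*-identityʳ (p * 1)) (*-identityʳ p))) p∤1

    ν-* : ∀ x y .{{_ : NonZero x}} .{{_ : NonZero y}} → ν (x * y) ≡ ν x + ν y
    ν-* x y =
      let r , x≡ , p∤r = ν-spec x ; s , y≡ , p∤s = ν-spec y in
      ν-unique (ν x + ν y) (r * s) (trans (cong₂ _*_ x≡ y≡) (regroup (ν x) (ν y) r s))
        λ p∣rs → [ p∤r , p∤s ]′ (euclidsLemma r s pp p∣rs)
      where
      regroup : ∀ e f r s → p ^ e * r * (p ^ f * s) ≡ p ^ (e + f) * (r * s)
      regroup e f r s = trans (solve (p ^ e) (p ^ f) r s) (cong (_* (r * s)) (sym (^-distribˡ-+-* p e f)))
        where
        solve : ∀ a b r s → a * r * (b * s) ≡ a * b * (r * s)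
        solve = solve-∀

    ν-^ : ∀ x k .{{_ : NonZero x}} → ν (x ^ k) ≡ k * ν x
    ν-^ x zero = ν-≡0 p∤1
    ν-^ x (suc k) = trans (ν-* x (x ^ k)) (cong (ν x +_) (ν-^ x k))
      where instance _ = m^n≢0 x k

    ≤ν⇒^∣ : ∀ x k .{{_ : NonZero x}} → k ≤ ν x → p ^ k ∣ x
    ≤ν⇒^∣ x k k≤ν =
      let r , x≡ , _ = ν-spec x in
      subst (p ^ k ∣_) (sym x≡) (∣-trans (^-monoʳ-∣ k≤ν) (m∣m*n r))

    ^∣⇒≤ν : ∀ x k .{{_ : NonZero x}} → p ^ k ∣ x → k ≤ ν x
    ^∣⇒≤ν x k p^k∣x with k ≤? ν x
    ... | yes k≤ν = k≤ν
    ... | no k≰ν =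
      let r , x≡ , p∤r = ν-spec x in
      ⊥-elim (p∤r (*-cancelˡ-∣ (p ^ ν x) {{m^n≢0 p (ν x)}}
        (subst₂ _∣_ (*-comm p (p ^ ν x)) x≡ (∣-trans (^-monoʳ-∣ (≰⇒> k≰ν)) p^k∣x))))

    ν-mono-∣ : ∀ x y .{{_ : NonZero x}} .{{_ : NonZero y}} → x ∣ y → ν x ≤ ν y
    ν-mono-∣ x y x∣y = ^∣⇒≤ν y (ν x) (∣-trans (≤ν⇒^∣ x (ν x) ≤-refl) x∣y)

    ν-gcd : ∀ x y .{{_ : NonZero x}} .{{_ : NonZero y}} → ν (gcd x y) ≡ ν x ⊓ ν y
    ν-gcd x y = ≤-antisym
      (⊓-glb (ν-mono-∣ _ x (gcd[m,n]∣m x y)) (ν-mono-∣ _ y (gcd[m,n]∣n x y)))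
      (^∣⇒≤ν (gcd x y) _ (gcd-greatest (≤ν⇒^∣ x _ (m⊓n≤m (ν x) (ν y))) (≤ν⇒^∣ y _ (m⊓n≤n (ν x) (ν y)))))
      where instance _ = gcd-nonZero x y

    ν-quotient : ∀ {m n} .{{_ : NonZero n}} (m∣n : m ∣ n) → ν (quotient m∣n) ≡ ν n ∸ ν m
    ν-quotient {m} {n} m∣n = begin
      ν q                ≡⟨ m+n∸n≡m (ν q) (ν m) ⟨
      ν q + ν m ∸ ν m    ≡⟨ cong (_∸ ν m) (sym (trans (cong ν (m∣n⇒n≡quotient*m m∣n)) (ν-* q m))) ⟩
      ν n ∸ ν m          ∎
      where
      open ≡-Reasoning
      q = quotient m∣n
      instance
        _ = quotient≢0 m∣n
        _ = m*n≢0⇒n≢0 q {{subst NonZero (m∣n⇒n≡quotient*m m∣n) it}}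

  ∣-by-ν : ∀ x y .{{_ : NonZero x}} .{{_ : NonZero y}} → (∀ {p} (pp : Prime p) → ν pp x ≤ ν pp y) → x ∣ y
  ∣-by-ν = <-rec Motive step
    where
    Motive : ℕ → Set
    Motive x = ∀ y .{{_ : NonZero x}} .{{_ : NonZero y}} → (∀ {p} (pp : Prime p) → ν pp x ≤ ν pp y) → x ∣ y

    step : ∀ x → (∀ {z} → z < x → Motive z) → Motive x
    step 1 _ y _ = 1∣ y
    step x@(2+ _) rec y ν≤ with prime-divisor x (s≤s (s≤s z≤n))
    ... | p , pp , divides q@(suc _) x≡qp = subst (_∣ y) (sym x≡qp) (q*p∣y p∣y)
      where
      instance _ = prime⇒nonZero pp

      ν-split : ∀ {r} (pr : Prime r) z .{{_ : NonZero z}} → ν pr (z * p) ≡ ν pr z + ν pr p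
      ν-split pr z = ν-* pr z p

      p∣y : p ∣ y
      p∣y = subst (_∣ y) (*-identityʳ p) (≤ν⇒^∣ pp y 1 (begin
        1                ≡⟨ sym (ν-self pp) ⟩
        ν pp p           ≤⟨ m≤n+m _ _ ⟩
        ν pp q + ν pp p  ≡⟨ sym (ν-split pp q) ⟩
        ν pp (q * p)     ≡⟨ cong (ν pp) (sym x≡qp) ⟩
        ν pp x           ≤⟨ ν≤ pp ⟩
        ν pp y           ∎))
        where open ≤-Reasoning

      q*p∣y : p ∣ y → q * p ∣ y
      q*p∣y (divides zero y≡0) = ⊥-elim (≢-nonZero⁻¹ y y≡0)
      q*p∣y (divides q′@(suc _) y≡q′p) = subst (q * p ∣_) (sym y≡q′p) (*-monoˡ-∣ p q∣q′)
        where
        q<x : q < x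
        q<x = subst (q <_) (sym x≡qp) (m<m*n q p (prime⇒2≤ pp))
        q∣q′ : q ∣ q′
        q∣q′ = rec q<x q′ λ pr → +-cancelʳ-≤ (ν pr p) _ _
          (subst₂ _≤_ (trans (cong (ν pr) x≡qp) (ν-split pr q)) (trans (cong (ν pr) y≡q′p) (ν-split pr q′)) (ν≤ pr))

  ν-prime-other : ∀ {p r} (pp : Prime p) → Prime r → r ≢ p → ν pp r ≡ 0
  ν-prime-other {p} {r} pp pr r≢p = ν-≡0 pp λ p∣r →
    [ (λ p≡1 → <⇒≱ (prime⇒2≤ pp) (≤-reflexive p≡1)) , (λ p≡r → r≢p (sym p≡r)) ]′ (prime⇒irreducible pr p∣r)

  -- ν-bound says that x / root² is squarefree.
  record SquareDivisor (x : ℕ) : Set where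
    field
      root : ℕ
      root-nonZero : NonZero root
      root²∣x : root * root ∣ x
      ν-bound : ∀ {p} (pp : Prime p) → ν pp x ≤ 2 * ν pp root + 1

  module _ {p : ℕ} (pp : Prime p) where

    private instance
      p≢0 : NonZero p
      p≢0 = prime⇒nonZero pp

    squareDivisor-*p² : ∀ {z} .{{_ : NonZero z}} → SquareDivisor z → SquareDivisor (z * (p * p))
    squareDivisor-*p² {z} s = record
      { root = root * p
      ; root-nonZero = m*n≢0 root p
      ; root²∣x = subst (_∣ z * (p * p)) (sym (square-* root p)) (*-monoˡ-∣ (p * p) root²∣x)
      ; ν-bound = λ pr → begin
          ν pr (z * (p * p))                    ≡⟨ ν-* pr z (p * p) ⟩
          ν pr z + ν pr (p * p)                 ≡⟨ cong (ν pr z +_) (ν-* pr p p) ⟩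
          ν pr z + (ν pr p + ν pr p)            ≤⟨ +-monoˡ-≤ _ (ν-bound pr) ⟩
          2 * ν pr root + 1 + (ν pr p + ν pr p) ≡⟨ regroup (ν pr root) (ν pr p) ⟩
          2 * (ν pr root + ν pr p) + 1          ≡⟨ cong (λ e → 2 * e + 1) (sym (ν-* pr root p)) ⟩
          2 * ν pr (root * p) + 1               ∎
      }
      where
      open ≤-Reasoning
      open SquareDivisor s
      instance
        _ = root-nonZero
        _ = m*n≢0 p p
      square-* : ∀ a b → a * b * (a * b) ≡ a * a * (b * b)
      square-* = solve-∀
      regroup : ∀ d e → 2 * d + 1 + (e + e) ≡ 2 * (d + e) + 1
      regroup = solve-∀

    squareDivisor-*p : ∀ {y} .{{_ : NonZero y}} → ¬ p ∣ y → SquareDivisor y → SquareDivisor (y * p)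
    squareDivisor-*p {y} p∤y s = record
      { root = root
      ; root-nonZero = root-nonZero
      ; root²∣x = ∣-trans root²∣x (m∣m*n p)
      ; ν-bound = λ pr → ≤-trans (≤-reflexive (ν-* pr y p)) (ν[y]+ν[p]≤ pr)
      }
      where
      open SquareDivisor s
      ν[y]+ν[p]≤ : ∀ {r} (pr : Prime r) → ν pr y + ν pr p ≤ 2 * ν pr root + 1
      ν[y]+ν[p]≤ {r} pr with r ≟ p
      ... | yes refl = subst (_≤ 2 * ν pr root + 1) (sym (cong₂ _+_ (ν-≡0 pr p∤y) (ν-self pr))) (m≤n+m 1 _)
      ... | no r≢p = subst (_≤ 2 * ν pr root + 1)
            (sym (trans (cong (ν pr y +_) (ν-prime-other pr pp (r≢p ∘ sym))) (+-identityʳ (ν pr y)))) (ν-bound pr)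

  squareDivisor : ∀ x .{{_ : NonZero x}} → SquareDivisor x
  squareDivisor = <-rec (λ x → .{{_ : NonZero x}} → SquareDivisor x) step
    where
    step : ∀ x → (∀ {y} → y < x → .{{_ : NonZero y}} → SquareDivisor y) → .{{_ : NonZero x}} → SquareDivisor x
    step 1 _ = record
      { root = 1 ; root-nonZero = _ ; root²∣x = ∣-refl
      ; ν-bound = λ pp → ≤-trans (≤-reflexive (ν-≡0 pp (p∤1 pp))) z≤n }
    step x@(2+ _) rec with prime-divisor x (s≤s (s≤s z≤n))
    ... | p , pp , divides y@(suc _) x≡yp with p ∣? y
    ...   | no p∤y = subst SquareDivisor (sym x≡yp) (squareDivisor-*p pp p∤y (rec y<x))
      where
      y<x : y < x
      y<x = subst (y <_) (sym x≡yp) (m<m*n y p (prime⇒2≤ pp))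
    ...   | yes (divides z@(suc _) y≡zp) = subst SquareDivisor (sym x≡zpp) (squareDivisor-*p² pp (rec z<x))
      where
      x≡zpp : x ≡ z * (p * p)
      x≡zpp = trans x≡yp (trans (cong (_* p) y≡zp) (*-assoc z p p))
      z<x : z < x
      z<x = subst (z <_) (sym x≡zpp) (m<m*n z (p * p) (*-mono-≤ (prime⇒2≤ pp) (≤-trans (s≤s z≤n) (prime⇒2≤ pp))))
        where instance _ = prime⇒nonZero pp

module ExponentBalance where

  open import Data.Nat
  open import Data.Nat.Properties
  open import Data.Nat.Divisibility using (_∣_; _∣?_)
  open import Data.Product using (_×_; _,_)
  open import Relation.Nullary.Decidable using (Dec; map′; _×-dec_; _→-dec_; from-yes)
  open import Relation.Binary.PropositionalEquality
  open import Data.Nat.Tactic.RingSolver using (solve-∀)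

  infix 4 _≈_±_

  _≈_±_ : ℕ → ℕ → ℕ → Set
  a ≈ b ± ε = a ≤ b + ε × b ≤ a + ε

  ≈±-weaken : ∀ {a b ε ε′} → ε ≤ ε′ → a ≈ b ± ε → a ≈ b ± ε′
  ≈±-weaken ε≤ε′ (a≤ , b≤) = ≤-trans a≤ (+-monoʳ-≤ _ ε≤ε′) , ≤-trans b≤ (+-monoʳ-≤ _ ε≤ε′)

  _≈?_±_ : ∀ a b ε → Dec (a ≈ b ± ε)
  a ≈? b ± ε = (a ≤? b + ε) ×-dec (b ≤? a + ε)

  -- For eᵢ = ν_p(aᵢ), u = a₁/(a₁,a₂), w = (a₁,a₂,a₃) and v = (a₁,a₂)/w, the fields compare
  -- ν_p(u³a₂²) with ν_p(a₁a₃a₄), ν_p(v³a₃²) with ν_p(a₁a₂a₄) and ν_p(w³a₄²) with ν_p(a₁a₂a₃).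
  record Balanced (e₁ e₂ e₃ e₄ ε : ℕ) : Set where
    constructor balancedᵉ
    field
      u-balanced : 3 * (e₁ ∸ e₁ ⊓ e₂) + 2 * e₂ ≈ e₁ + e₃ + e₄ ± ε
      v-balanced : 3 * (e₁ ⊓ e₂ ∸ e₁ ⊓ e₂ ⊓ e₃) + 2 * e₃ ≈ e₁ + e₂ + e₄ ± ε
      w-balanced : 3 * (e₁ ⊓ e₂ ⊓ e₃) + 2 * e₄ ≈ e₁ + e₂ + e₃ ± ε

  balanced? : ∀ e₁ e₂ e₃ e₄ ε → Dec (Balanced e₁ e₂ e₃ e₄ ε)
  balanced? e₁ e₂ e₃ e₄ ε = map′ (λ (u , v , w) → balancedᵉ u v w) (λ (balancedᵉ u v w) → u , v , w)
    ((_ ≈? _ ± ε) ×-dec (_ ≈? _ ± ε) ×-dec (_ ≈? _ ± ε))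

  balanced-weaken : ∀ {e₁ e₂ e₃ e₄ ε ε′} → ε ≤ ε′ → Balanced e₁ e₂ e₃ e₄ ε → Balanced e₁ e₂ e₃ e₄ ε′
  balanced-weaken ε≤ε′ (balancedᵉ u v w) = balancedᵉ (≈±-weaken ε≤ε′ u) (≈±-weaken ε≤ε′ v) (≈±-weaken ε≤ε′ w)

  squarefree-balanced : ∀ {e₁} → e₁ < 2 → ∀ {e₂} → e₂ < 2 → ∀ {e₃} → e₃ < 2 → ∀ {e₄} → e₄ < 2 →
    3 ∣ e₁ + e₂ + e₃ + e₄ → Balanced e₁ e₂ e₃ e₄ 0
  squarefree-balanced = from-yes
    (allUpTo? (λ e₁ → allUpTo? (λ e₂ → allUpTo? (λ e₃ → allUpTo? (λ e₄ →
      3 ∣? e₁ + e₂ + e₃ + e₄ →-dec balanced? e₁ e₂ e₃ e₄ 0) 2) 2) 2) 2)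

  balanced-by-pairs : ∀ {e₁ e₂ e₃ e₄} B → e₁ + e₂ ≤ B → e₁ + e₃ ≤ B → e₃ + e₄ ≤ B → Balanced e₁ e₂ e₃ e₄ (2 * B)
  balanced-by-pairs {e₁} {e₂} {e₃} {e₄} B e₁₂≤B e₁₃≤B e₃₄≤B = balancedᵉ
    (u-upper , ≤+2B (3 * U + 2 * e₂) (+-monoˡ-≤ e₄ (+-monoˡ-≤ e₃ (m≤m+n e₁ e₂))))
    (v-upper , ≤+2B (3 * V + 2 * e₃) (+-monoˡ-≤ e₄ (m≤m+n (e₁ + e₂) e₃)))
    (w-upper , ≤+2B (3 * W + 2 * e₄) (m≤m+n (e₁ + e₂ + e₃) e₄))
    where
    open ≤-Reasoning
    m = e₁ ⊓ e₂
    U = e₁ ∸ m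
    W = m ⊓ e₃
    V = m ∸ W
    U≤e₁ : U ≤ e₁
    U≤e₁ = m∸n≤m e₁ m
    V≤e₁ : V ≤ e₁
    V≤e₁ = ≤-trans (m∸n≤m m W) (m⊓n≤m e₁ e₂)
    V≤e₂ : V ≤ e₂
    V≤e₂ = ≤-trans (m∸n≤m m W) (m⊓n≤n e₁ e₂)
    W≤e₁ : W ≤ e₁
    W≤e₁ = ≤-trans (m⊓n≤m m e₃) (m⊓n≤m e₁ e₂)
    W≤e₂ : W ≤ e₂
    W≤e₂ = ≤-trans (m⊓n≤m m e₃) (m⊓n≤n e₁ e₂)
    W≤e₃ : W ≤ e₃
    W≤e₃ = m⊓n≤n m e₃
    ≤+2B : ∀ {t} x → t ≤ e₁ + e₂ + e₃ + e₄ → t ≤ x + 2 * B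
    ≤+2B x t≤∑e = ≤-trans t≤∑e (≤-trans (≤-reflexive (+-assoc (e₁ + e₂) e₃ e₄))
      (≤-trans (+-mono-≤ e₁₂≤B e₃₄≤B) (≤-trans (≤-reflexive (B+B≡2*B B)) (m≤n+m (2 * B) x))))
      where
      B+B≡2*B : ∀ B → B + B ≡ 2 * B
      B+B≡2*B = solve-∀

    u-upper : 3 * U + 2 * e₂ ≤ e₁ + e₃ + e₄ + 2 * B
    u-upper = begin
      3 * U + 2 * e₂        ≡⟨ regroup U e₂ ⟩
      U + 2 * (U + e₂)      ≤⟨ +-mono-≤ U≤e₁ (*-monoʳ-≤ 2 (≤-trans (+-monoˡ-≤ e₂ U≤e₁) e₁₂≤B)) ⟩
      e₁ + 2 * B            ≤⟨ +-monoˡ-≤ (2 * B) (≤-trans (m≤m+n e₁ e₃) (m≤m+n (e₁ + e₃) e₄)) ⟩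
      e₁ + e₃ + e₄ + 2 * B  ∎
      where
      regroup : ∀ u a → 3 * u + 2 * a ≡ u + 2 * (u + a)
      regroup = solve-∀

    v-upper : 3 * V + 2 * e₃ ≤ e₁ + e₂ + e₄ + 2 * B
    v-upper = begin
      3 * V + 2 * e₃        ≤⟨ m≤m+n (3 * V + 2 * e₃) V ⟩
      3 * V + 2 * e₃ + V    ≡⟨ regroup V e₃ ⟩
      V + V + 2 * (V + e₃)  ≤⟨ +-mono-≤ (+-mono-≤ V≤e₁ V≤e₂) (*-monoʳ-≤ 2 (≤-trans (+-monoˡ-≤ e₃ V≤e₁) e₁₃≤B)) ⟩
      e₁ + e₂ + 2 * B       ≤⟨ +-monoˡ-≤ (2 * B) (m≤m+n (e₁ + e₂) e₄) ⟩
      e₁ + e₂ + e₄ + 2 * B  ∎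
      where
      regroup : ∀ v a → 3 * v + 2 * a + v ≡ v + v + 2 * (v + a)
      regroup = solve-∀

    w-upper : 3 * W + 2 * e₄ ≤ e₁ + e₂ + e₃ + 2 * B
    w-upper = begin
      3 * W + 2 * e₄        ≡⟨ cong (_+ 2 * e₄) (regroup W) ⟩
      W + W + W + 2 * e₄    ≤⟨ +-mono-≤ (+-mono-≤ (+-mono-≤ W≤e₁ W≤e₂) W≤e₃) (*-monoʳ-≤ 2 (≤-trans (m≤n+m e₄ e₃) e₃₄≤B)) ⟩
      e₁ + e₂ + e₃ + 2 * B  ∎
      where
      regroup : ∀ w → 3 * w ≡ w + w + w
      regroup = solve-∀

  -- Exact when all fᵢ vanish (then every eᵢ ≤ 1); otherwise ∑f ≥ 1 absorbs the crude bound eᵢ + eⱼ ≤ 2∑f + 2.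
  balanced : ∀ {e₁ e₂ e₃ e₄} f₁ f₂ f₃ f₄ →
    e₁ ≤ 2 * f₁ + 1 → e₂ ≤ 2 * f₂ + 1 → e₃ ≤ 2 * f₃ + 1 → e₄ ≤ 2 * f₄ + 1 →
    3 ∣ e₁ + e₂ + e₃ + e₄ → Balanced e₁ e₂ e₃ e₄ (8 * (f₁ + f₂ + f₃ + f₄))
  balanced {e₁} {e₂} {e₃} {e₄} f₁ f₂ f₃ f₄ b₁ b₂ b₃ b₄ 3∣∑e = by-size (f₁ + f₂ + f₃ + f₄) refl
    where
    ∑f = f₁ + f₂ + f₃ + f₄

    f₁+f₂≤∑f : f₁ + f₂ ≤ ∑f
    f₁+f₂≤∑f = ≤-trans (m≤m+n _ f₃) (m≤m+n _ f₄)
    f₁+f₃≤∑f : f₁ + f₃ ≤ ∑f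
    f₁+f₃≤∑f = ≤-trans (+-monoˡ-≤ f₃ (m≤m+n f₁ f₂)) (m≤m+n _ f₄)
    f₃+f₄≤∑f : f₃ + f₄ ≤ ∑f
    f₃+f₄≤∑f = ≤-trans (m≤n+m _ (f₁ + f₂)) (≤-reflexive (sym (+-assoc (f₁ + f₂) f₃ f₄)))

    pair≤ : ∀ {e e′} f f′ → e ≤ 2 * f + 1 → e′ ≤ 2 * f′ + 1 → f + f′ ≤ ∑f → e + e′ ≤ 2 * ∑f + 2
    pair≤ f f′ e≤ e′≤ f+f′≤ = ≤-trans (+-mono-≤ e≤ e′≤)
      (≤-trans (≤-reflexive (regroup f f′)) (+-monoˡ-≤ 2 (*-monoʳ-≤ 2 f+f′≤)))
      where
      regroup : ∀ f f′ → 2 * f + 1 + (2 * f′ + 1) ≡ 2 * (f + f′) + 2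
      regroup = solve-∀

    <2 : ∀ {e f} → e ≤ 2 * f + 1 → f ≤ 0 → e < 2
    <2 e≤ z≤n = s≤s e≤

    by-size : ∀ F → ∑f ≡ F → Balanced e₁ e₂ e₃ e₄ (8 * F)
    by-size zero ∑f≡0 = balanced-weaken z≤n (squarefree-balanced
      (<2 b₁ (f≤0 (≤-trans (m≤m+n f₁ f₂) f₁+f₂≤∑f))) (<2 b₂ (f≤0 (≤-trans (m≤n+m f₂ f₁) f₁+f₂≤∑f)))
      (<2 b₃ (f≤0 (≤-trans (m≤m+n f₃ f₄) f₃+f₄≤∑f))) (<2 b₄ (f≤0 (≤-trans (m≤n+m f₄ f₃) f₃+f₄≤∑f)))
      3∣∑e)
      where
      f≤0 : ∀ {f} → f ≤ ∑f → f ≤ 0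
      f≤0 {f} f≤ = subst (f ≤_) ∑f≡0 f≤
    by-size (suc k) ∑f≡1+k = subst (λ F → Balanced e₁ e₂ e₃ e₄ (8 * F)) ∑f≡1+k (balanced-weaken
      (subst (λ F → 2 * (2 * F + 2) ≤ 8 * F) (sym ∑f≡1+k) (2[2F+2]≤8F k))
      (balanced-by-pairs (2 * ∑f + 2) (pair≤ f₁ f₂ b₁ b₂ f₁+f₂≤∑f) (pair≤ f₁ f₃ b₁ b₃ f₁+f₃≤∑f) (pair≤ f₃ f₄ b₃ b₄ f₃+f₄≤∑f)))
      where
      2[2F+2]≤8F : ∀ k → 2 * (2 * suc k + 2) ≤ 8 * suc k
      2[2F+2]≤8F k = ≤-trans (m≤m+n _ (4 * k)) (≤-reflexive (regroup k))
        where
        regroup : ∀ k → 2 * (2 * suc k + 2) + 4 * k ≡ 8 * suc k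
        regroup = solve-∀

module GcdDecomposition where

  open import Data.Nat
  open import Data.Nat.Properties
  open import Data.Nat.Divisibility
  open import Data.Nat.GCD using (gcd; gcd[m,n]∣m)
  open import Data.Nat.Primality using (Prime)
  open import Data.Product using (_×_; _,_)
  open import Relation.Binary.PropositionalEquality
  open import Data.Nat.Tactic.RingSolver using (solve-∀)
  open PrimeValuation
  open ExponentBalance

  infix 4 _≈_×÷_

  _≈_×÷_ : ℕ → ℕ → ℕ → Set
  a ≈ b ×÷ E = a ≤ b * E × b ≤ a * E

  module _ {p} (pp : Prime p) where

    ν-*³ : ∀ x y z .{{_ : NonZero x}} .{{_ : NonZero y}} .{{_ : NonZero z}} →
      ν pp (x * y * z) ≡ ν pp x + ν pp y + ν pp z
    ν-*³ x y z = trans (ν-* pp (x * y) z) (cong (_+ ν pp z) (ν-* pp x y))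
      where instance _ = m*n≢0 x y

    ν-*⁴ : ∀ x y z t .{{_ : NonZero x}} .{{_ : NonZero y}} .{{_ : NonZero z}} .{{_ : NonZero t}} →
      ν pp (x * y * z * t) ≡ ν pp x + ν pp y + ν pp z + ν pp t
    ν-*⁴ x y z t = trans (ν-* pp (x * y * z) t) (cong (_+ ν pp t) (ν-*³ x y z))
      where instance _ = m*n≢0 (x * y) z ; _ = m*n≢0 x y

    ν-cube*square : ∀ x y .{{_ : NonZero x}} .{{_ : NonZero y}} →
      ν pp (x * x * x * (y * y)) ≡ 3 * ν pp x + 2 * ν pp y
    ν-cube*square x y = trans (ν-* pp (x * x * x) (y * y))
      (cong₂ _+_ (trans (ν-*³ x x x) (x+x+x≡3x (ν pp x))) (trans (ν-* pp y y) (x+x≡2x (ν pp y))))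
      where
      instance _ = m*n≢0 (x * x) x ; _ = m*n≢0 x x ; _ = m*n≢0 y y
      x+x+x≡3x : ∀ x → x + x + x ≡ 3 * x
      x+x+x≡3x = solve-∀
      x+x≡2x : ∀ x → x + x ≡ 2 * x
      x+x≡2x = solve-∀

  ≈×÷-by-ν : ∀ a b E .{{_ : NonZero a}} .{{_ : NonZero b}} .{{_ : NonZero E}} →
    (∀ {p} (pp : Prime p) → ν pp a ≈ ν pp b ± ν pp E) → a ≈ b ×÷ E
  ≈×÷-by-ν a b E ν≈ = ≤-by-ν a b (λ pp → let a≤ , _ = ν≈ pp in a≤) , ≤-by-ν b a (λ pp → let _ , b≤ = ν≈ pp in b≤)
    where
    ≤-by-ν : ∀ x y .{{_ : NonZero x}} .{{_ : NonZero y}} → (∀ {p} (pp : Prime p) → ν pp x ≤ ν pp y + ν pp E) → x ≤ y * E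
    ≤-by-ν x y ν≤ = ∣⇒≤ (∣-by-ν x (y * E) λ pp → subst (ν pp x ≤_) (sym (ν-* pp y E)) (ν≤ pp))
      where instance _ = m*n≢0 y E

  cube*square≈*³-by-ν : ∀ x y a b c E .{{_ : NonZero x}} .{{_ : NonZero y}} →
    .{{_ : NonZero a}} .{{_ : NonZero b}} .{{_ : NonZero c}} .{{_ : NonZero E}} →
    (∀ {p} (pp : Prime p) → 3 * ν pp x + 2 * ν pp y ≈ ν pp a + ν pp b + ν pp c ± ν pp E) →
    x * x * x * (y * y) ≈ a * b * c ×÷ E
  cube*square≈*³-by-ν x y a b c E ν≈ = ≈×÷-by-ν _ _ E λ pp →
    subst₂ (_≈_± ν pp E) (sym (ν-cube*square pp x y)) (sym (ν-*³ pp a b c)) (ν≈ pp)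
    where
    instance
      _ = m*n≢0 (x * x * x) (y * y) ; _ = m*n≢0 (x * x) x ; _ = m*n≢0 x x ; _ = m*n≢0 y y
      _ = m*n≢0 (a * b) c ; _ = m*n≢0 a b

  record Decomposition (a₁ a₂ a₃ a₄ E : ℕ) : Set where
    field
      u v w : ℕ
      u-nonZero : NonZero u
      v-nonZero : NonZero v
      w-nonZero : NonZero w
      a₁≡u*v*w : a₁ ≡ u * v * w
      u-balanced : u * u * u * (a₂ * a₂) ≈ a₁ * a₃ * a₄ ×÷ E
      v-balanced : v * v * v * (a₃ * a₃) ≈ a₁ * a₂ * a₄ ×÷ E
      w-balanced : w * w * w * (a₄ * a₄) ≈ a₁ * a₂ * a₃ ×÷ E

  decomposition : ∀ {a₁ a₂ a₃ a₄ m} .{{_ : NonZero a₁}} .{{_ : NonZero a₂}} .{{_ : NonZero a₃}} .{{_ : NonZero a₄}} →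
    a₁ * a₂ * a₃ * a₄ ≡ m * m * m →
    (s₁ : SquareDivisor a₁) (s₂ : SquareDivisor a₂) (s₃ : SquareDivisor a₃) (s₄ : SquareDivisor a₄) →
    let open SquareDivisor in Decomposition a₁ a₂ a₃ a₄ ((root s₁ * root s₂ * root s₃ * root s₄) ^ 8)
  decomposition {a₁} {a₂} {a₃} {a₄} {m} a₁a₂a₃a₄≡m³ s₁ s₂ s₃ s₄ = record
    { u = u ; v = v ; w = w
    ; u-nonZero = quotient≢0 g∣a₁ ; v-nonZero = quotient≢0 w∣g ; w-nonZero = gcd-nonZero g a₃
    ; a₁≡u*v*w = trans (m∣n⇒n≡quotient*m g∣a₁) (trans (cong (u *_) (m∣n⇒n≡quotient*m w∣g)) (sym (*-assoc u v w)))
    ; u-balanced = cube*square≈*³-by-ν u a₂ a₁ a₃ a₄ E u-exponents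
    ; v-balanced = cube*square≈*³-by-ν v a₃ a₁ a₂ a₄ E v-exponents
    ; w-balanced = cube*square≈*³-by-ν w a₄ a₁ a₂ a₃ E w-exponents
    }
    where
    open SquareDivisor
    g = gcd a₁ a₂
    g∣a₁ = gcd[m,n]∣m a₁ a₂
    w = gcd g a₃
    w∣g = gcd[m,n]∣m g a₃
    u = quotient g∣a₁
    v = quotient w∣g
    r₁ = root s₁ ; r₂ = root s₂ ; r₃ = root s₃ ; r₄ = root s₄
    E = (r₁ * r₂ * r₃ * r₄) ^ 8

    instance
      _ = gcd-nonZero a₁ a₂ ; _ = gcd-nonZero g a₃ ; _ = quotient≢0 g∣a₁ ; _ = quotient≢0 w∣g
      _ = root-nonZero s₁ ; _ = root-nonZero s₂ ; _ = root-nonZero s₃ ; _ = root-nonZero s₄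
      _ = m*n≢0 r₁ r₂ ; _ = m*n≢0 (r₁ * r₂) r₃ ; _ = m*n≢0 (r₁ * r₂ * r₃) r₄ ; _ = m^n≢0 (r₁ * r₂ * r₃ * r₄) 8
      _ = m*n≢0 a₁ a₂ ; _ = m*n≢0 (a₁ * a₂) a₃ ; _ = m*n≢0 (a₁ * a₂ * a₃) a₄
      m≢0 : NonZero m
      m≢0 = ≢-nonZero λ m≡0 → ≢-nonZero⁻¹ (a₁ * a₂ * a₃ * a₄) (trans a₁a₂a₃a₄≡m³ (cong (λ m → m * m * m) m≡0))

    module _ {p} (pp : Prime p) where
      e₁ = ν pp a₁ ; e₂ = ν pp a₂ ; e₃ = ν pp a₃ ; e₄ = ν pp a₄

      ν-g : ν pp g ≡ e₁ ⊓ e₂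
      ν-g = ν-gcd pp a₁ a₂

      ν-w : ν pp w ≡ e₁ ⊓ e₂ ⊓ e₃
      ν-w = trans (ν-gcd pp g a₃) (cong (_⊓ e₃) ν-g)

      ν-E : ν pp E ≡ 8 * (ν pp r₁ + ν pp r₂ + ν pp r₃ + ν pp r₄)
      ν-E = trans (ν-^ pp (r₁ * r₂ * r₃ * r₄) 8) (cong (8 *_) (ν-*⁴ pp r₁ r₂ r₃ r₄))

      3∣∑e : 3 ∣ e₁ + e₂ + e₃ + e₄
      3∣∑e = divides (ν pp m) (begin
        e₁ + e₂ + e₃ + e₄               ≡⟨ ν-*⁴ pp a₁ a₂ a₃ a₄ ⟨
        ν pp (a₁ * a₂ * a₃ * a₄)        ≡⟨ cong (ν pp) a₁a₂a₃a₄≡m³ ⟩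
        ν pp (m * m * m)                ≡⟨ ν-*³ pp m m m ⟩
        ν pp m + ν pp m + ν pp m        ≡⟨ x+x+x≡x*3 (ν pp m) ⟩
        ν pp m * 3                      ∎)
        where
        open ≡-Reasoning
        x+x+x≡x*3 : ∀ x → x + x + x ≡ x * 3
        x+x+x≡x*3 = solve-∀

      open Balanced (balanced (ν pp r₁) (ν pp r₂) (ν pp r₃) (ν pp r₄)
        (ν-bound s₁ pp) (ν-bound s₂ pp) (ν-bound s₃ pp) (ν-bound s₄ pp) 3∣∑e)

      u-exponents : 3 * ν pp u + 2 * e₂ ≈ e₁ + e₃ + e₄ ± ν pp E
      u-exponents = subst₂ (λ U ε → 3 * U + 2 * e₂ ≈ e₁ + e₃ + e₄ ± ε)
        (sym (trans (ν-quotient pp g∣a₁) (cong (e₁ ∸_) ν-g))) (sym ν-E) u-balanced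

      v-exponents : 3 * ν pp v + 2 * e₃ ≈ e₁ + e₂ + e₄ ± ν pp E
      v-exponents = subst₂ (λ V ε → 3 * V + 2 * e₃ ≈ e₁ + e₂ + e₄ ± ε)
        (sym (trans (ν-quotient pp w∣g) (cong₂ _∸_ ν-g ν-w))) (sym ν-E) v-balanced

      w-exponents : 3 * ν pp w + 2 * e₄ ≈ e₁ + e₂ + e₃ ± ν pp E
      w-exponents = subst₂ (λ W ε → 3 * W + 2 * e₄ ≈ e₁ + e₂ + e₃ ± ε) (sym ν-w) (sym ν-E) w-balanced

module RationalBounds where

  open import Defs
  import Data.Nat as ℕ
  import Data.Nat.Properties as ℕ
  open import Data.Nat using (ℕ; zero; suc)
  import Data.Integer as ℤ
  import Data.Integer.Properties as ℤ
  open import Data.Integer using (+_)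
  open import Data.Rational
  open import Data.Rational.Properties
  import Data.Rational.Unnormalised as ℚᵘ
  import Data.Rational.Unnormalised.Properties as ℚᵘ
  open import Data.Rational.Solver using (module +-*-Solver)
  open import Relation.Nullary.Decidable using (from-yes; from-no)
  open import Data.Product using (_,_)
  open import Relation.Nullary using (¬_)
  open import Relation.Binary.PropositionalEquality

  open +-*-Solver

  private
    [_/_]ᵘ : ℤ.ℤ → ℕ → ℚᵘ.ℚᵘ
    [ n / d ]ᵘ = ℚᵘ.mkℚᵘ n d

    fromℚᵘ-mono-≤ : ∀ {p q} → p ℚᵘ.≤ q → fromℚᵘ p ≤ fromℚᵘ q
    fromℚᵘ-mono-≤ {p} {q} p≤q = toℚᵘ-cancel-≤
      (ℚᵘ.≤-respˡ-≃ (ℚᵘ.≃-sym (toℚᵘ-fromℚᵘ p)) (ℚᵘ.≤-respʳ-≃ (ℚᵘ.≃-sym (toℚᵘ-fromℚᵘ q)) p≤q))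

    fromℚᵘ-mono-< : ∀ {p q} → p ℚᵘ.< q → fromℚᵘ p < fromℚᵘ q
    fromℚᵘ-mono-< {p} {q} p<q = toℚᵘ-cancel-<
      (ℚᵘ.<-respˡ-≃ (ℚᵘ.≃-sym (toℚᵘ-fromℚᵘ p)) (ℚᵘ.<-respʳ-≃ (ℚᵘ.≃-sym (toℚᵘ-fromℚᵘ q)) p<q))

    fromℚᵘ-* : ∀ p q → fromℚᵘ (p ℚᵘ.* q) ≡ fromℚᵘ p * fromℚᵘ q
    fromℚᵘ-* p q = toℚᵘ-injective (ℚᵘ.≃-trans (toℚᵘ-fromℚᵘ (p ℚᵘ.* q))
      (ℚᵘ.≃-sym (ℚᵘ.≃-trans (toℚᵘ-homo-* (fromℚᵘ p) (fromℚᵘ q)) (ℚᵘ.*-cong (toℚᵘ-fromℚᵘ p) (toℚᵘ-fromℚᵘ q)))))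

  ℕtoℚ-* : ∀ a b → ℕtoℚ (a ℕ.* b) ≡ ℕtoℚ a * ℕtoℚ b
  ℕtoℚ-* a b = trans
    (fromℚᵘ-cong {[ + (a ℕ.* b) / 0 ]ᵘ} {[ + a / 0 ]ᵘ ℚᵘ.* [ + b / 0 ]ᵘ} (ℚᵘ.*≡* (cong (ℤ._* + 1) (ℤ.pos-* a b))))
    (fromℚᵘ-* [ + a / 0 ]ᵘ [ + b / 0 ]ᵘ)

  ℕtoℚ-*³ : ∀ a b c → ℕtoℚ (a ℕ.* b ℕ.* c) ≡ ℕtoℚ a * ℕtoℚ b * ℕtoℚ c
  ℕtoℚ-*³ a b c = trans (ℕtoℚ-* (a ℕ.* b) c) (cong (_* ℕtoℚ c) (ℕtoℚ-* a b))

  ℕtoℚ-mono-≤ : ∀ {a b} → a ℕ.≤ b → ℕtoℚ a ≤ ℕtoℚ b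
  ℕtoℚ-mono-≤ {a} {b} a≤b = fromℚᵘ-mono-≤ {[ + a / 0 ]ᵘ} {[ + b / 0 ]ᵘ}
    (ℚᵘ.*≤* (subst₂ ℤ._≤_ (sym (ℤ.*-identityʳ (+ a))) (sym (ℤ.*-identityʳ (+ b))) (ℤ.+≤+ a≤b)))

  ℕtoℚ-mono-< : ∀ {a b} → a ℕ.< b → ℕtoℚ a < ℕtoℚ b
  ℕtoℚ-mono-< {a} {b} a<b = fromℚᵘ-mono-< {[ + a / 0 ]ᵘ} {[ + b / 0 ]ᵘ}
    (ℚᵘ.*<* (subst₂ ℤ._<_ (sym (ℤ.*-identityʳ (+ a))) (sym (ℤ.*-identityʳ (+ b))) (ℤ.+<+ a<b)))

  0≤n/d : ∀ n d → 0ℚ ≤ + n / suc d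
  0≤n/d n d = fromℚᵘ-mono-≤ {[ + 0 / 0 ]ᵘ} {[ + n / d ]ᵘ} (ℚᵘ.*≤* (subst (+ 0 ℤ.≤_) (sym (ℤ.*-identityʳ (+ n))) (ℤ.+≤+ ℕ.z≤n)))

  0≤ℕtoℚ : ∀ n → 0ℚ ≤ ℕtoℚ n
  0≤ℕtoℚ n = 0≤n/d n 0

  n/d*d≡n : ∀ n d → (+ n / suc d) * ℕtoℚ (suc d) ≡ ℕtoℚ n
  n/d*d≡n n d = trans (sym (fromℚᵘ-* [ + n / d ]ᵘ [ + suc d / 0 ]ᵘ))
    (fromℚᵘ-cong {[ + n / d ]ᵘ ℚᵘ.* [ + suc d / 0 ]ᵘ} {[ + n / 0 ]ᵘ}
      (ℚᵘ.*≡* (trans (ℤ.*-identityʳ _) (cong (λ k → + n ℤ.* + suc k) (sym (ℕ.*-identityʳ d))))))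

  0≤* : ∀ {a b} → 0ℚ ≤ a → 0ℚ ≤ b → 0ℚ ≤ a * b
  0≤* {a} {b} 0≤a 0≤b = nonNegative⁻¹ (a * b) {{nonNeg*nonNeg⇒nonNeg a {{nonNegative 0≤a}} b {{nonNegative 0≤b}}}}

  0<* : ∀ {a b} → 0ℚ < a → 0ℚ < b → 0ℚ < a * b
  0<* {a} {b} 0<a 0<b = positive⁻¹ (a * b) {{pos*pos⇒pos a {{positive 0<a}} b {{positive 0<b}}}}

  *-monoˡ-≤-0≤ : ∀ {r p q} → 0ℚ ≤ r → p ≤ q → r * p ≤ r * q
  *-monoˡ-≤-0≤ {r} 0≤r = *-monoˡ-≤-nonNeg r {{nonNegative 0≤r}}

  *-monoʳ-≤-0≤ : ∀ {r p q} → 0ℚ ≤ r → p ≤ q → p * r ≤ q * r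
  *-monoʳ-≤-0≤ {r} 0≤r = *-monoʳ-≤-nonNeg r {{nonNegative 0≤r}}

  *-mono-≤-0≤ : ∀ {a b c d} → 0ℚ ≤ a → 0ℚ ≤ c → a ≤ b → c ≤ d → a * c ≤ b * d
  *-mono-≤-0≤ 0≤a 0≤c a≤b c≤d = ≤-trans (*-monoʳ-≤-0≤ 0≤c a≤b) (*-monoˡ-≤-0≤ (≤-trans 0≤a a≤b) c≤d)

  *-monoʳ-<-0< : ∀ {r p q} → 0ℚ < r → p < q → r * p < r * q
  *-monoʳ-<-0< {r} 0<r = *-monoʳ-<-pos r {{positive 0<r}}

  *-cancelʳ-≤-0< : ∀ {r p q} → 0ℚ < r → p * r ≤ q * r → p ≤ q
  *-cancelʳ-≤-0< {r} 0<r = *-cancelʳ-≤-pos r {{positive 0<r}}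

  0≤^ : ∀ {x} k → 0ℚ ≤ x → 0ℚ ≤ x ^ℚ k
  0≤^ zero _ = from-yes (0ℚ ≤? 1ℚ)
  0≤^ (suc k) 0≤x = 0≤* (0≤^ k 0≤x) 0≤x

  0<^ : ∀ {x} k → 0ℚ < x → 0ℚ < x ^ℚ k
  0<^ zero _ = from-yes (0ℚ <? 1ℚ)
  0<^ (suc k) 0<x = 0<* (0<^ k 0<x) 0<x

  ^-monoˡ-≤ : ∀ {x y} k → 0ℚ ≤ x → x ≤ y → x ^ℚ k ≤ y ^ℚ k
  ^-monoˡ-≤ zero _ _ = ≤-refl
  ^-monoˡ-≤ (suc k) 0≤x x≤y = *-mono-≤-0≤ (0≤^ k 0≤x) 0≤x (^-monoˡ-≤ k 0≤x x≤y) x≤y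

  ^-+ : ∀ x a b → x ^ℚ (a ℕ.+ b) ≡ x ^ℚ a * x ^ℚ b
  ^-+ x a zero = trans (cong (x ^ℚ_) (ℕ.+-identityʳ a)) (sym (*-identityʳ (x ^ℚ a)))
  ^-+ x a (suc b) = trans (cong (x ^ℚ_) (ℕ.+-suc a b)) (trans (cong (_* x) (^-+ x a b)) (*-assoc (x ^ℚ a) (x ^ℚ b) x))

  ^-distribʳ-* : ∀ x y k → (x * y) ^ℚ k ≡ x ^ℚ k * y ^ℚ k
  ^-distribʳ-* x y zero = sym (*-identityˡ 1ℚ)
  ^-distribʳ-* x y (suc k) = trans (cong (_* (x * y)) (^-distribʳ-* x y k)) (interchange (x ^ℚ k) (y ^ℚ k) x y)
    where
    interchange : ∀ a b c d → a * b * (c * d) ≡ a * c * (b * d)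
    interchange = solve 4 (λ a b c d → a :* b :* (c :* d) := a :* c :* (b :* d)) refl

  ^-* : ∀ x a b → (x ^ℚ a) ^ℚ b ≡ x ^ℚ (a ℕ.* b)
  ^-* x a zero = cong (x ^ℚ_) (sym (ℕ.*-zeroʳ a))
  ^-* x a (suc b) = trans (cong (_* x ^ℚ a) (^-* x a b))
    (trans (sym (^-+ x (a ℕ.* b) a)) (cong (x ^ℚ_) (trans (ℕ.+-comm (a ℕ.* b) a) (sym (ℕ.*-suc a b)))))

  ℕtoℚ-^ : ∀ a k → ℕtoℚ (a ℕ.^ k) ≡ ℕtoℚ a ^ℚ k
  ℕtoℚ-^ a zero = refl
  ℕtoℚ-^ a (suc k) = trans (ℕtoℚ-* a (a ℕ.^ k)) (trans (*-comm (ℕtoℚ a) _) (cong (_* ℕtoℚ a) (ℕtoℚ-^ a k)))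

  ℕtoℚ-∏⁴-^≤ : ∀ a b c d {M} k → ℕtoℚ a ≤ M → ℕtoℚ b ≤ M → ℕtoℚ c ≤ M → ℕtoℚ d ≤ M →
    ℕtoℚ ((a ℕ.* b ℕ.* c ℕ.* d) ℕ.^ k) ≤ M ^ℚ (4 ℕ.* k)
  ℕtoℚ-∏⁴-^≤ a b c d {M} k a≤M b≤M c≤M d≤M = begin
    ℕtoℚ ((a ℕ.* b ℕ.* c ℕ.* d) ℕ.^ k)   ≡⟨ ℕtoℚ-^ (a ℕ.* b ℕ.* c ℕ.* d) k ⟩
    ℕtoℚ (a ℕ.* b ℕ.* c ℕ.* d) ^ℚ k      ≤⟨ ^-monoˡ-≤ k (0≤ℕtoℚ (a ℕ.* b ℕ.* c ℕ.* d)) abcd≤M⁴ ⟩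
    (M ^ℚ 4) ^ℚ k                        ≡⟨ ^-* M 4 k ⟩
    M ^ℚ (4 ℕ.* k)                       ∎
    where
    open ≤-Reasoning
    0≤ = 0≤ℕtoℚ
    abcd≤M⁴ : ℕtoℚ (a ℕ.* b ℕ.* c ℕ.* d) ≤ M ^ℚ 4
    abcd≤M⁴ = begin
      ℕtoℚ (a ℕ.* b ℕ.* c ℕ.* d)                ≡⟨ trans (ℕtoℚ-* (a ℕ.* b ℕ.* c) d) (cong (_* ℕtoℚ d) (ℕtoℚ-*³ a b c)) ⟩
      ℕtoℚ a * ℕtoℚ b * ℕtoℚ c * ℕtoℚ d          ≤⟨ *-mono-≤-0≤ (0≤* (0≤* (0≤ a) (0≤ b)) (0≤ c)) (0≤ d)
                                                     (*-mono-≤-0≤ (0≤* (0≤ a) (0≤ b)) (0≤ c) (*-mono-≤-0≤ (0≤ a) (0≤ b) a≤M b≤M) c≤M) d≤M ⟩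
      M * M * M * M                              ≡⟨ cong (λ M′ → M′ * M * M * M) (*-identityˡ M) ⟨
      M ^ℚ 4                                     ∎

  ^-≤-base : ∀ {t} k → 0ℚ ≤ t → t ≤ 1ℚ → t ^ℚ suc k ≤ t
  ^-≤-base {t} k 0≤t t≤1 = ≤-trans (*-monoʳ-≤-0≤ 0≤t (^≤1 k)) (≤-reflexive (*-identityˡ t))
    where
    ^≤1 : ∀ k → t ^ℚ k ≤ 1ℚ
    ^≤1 zero = ≤-refl
    ^≤1 (suc k) = ≤-trans (*-mono-≤-0≤ (0≤^ k 0≤t) 0≤t (^≤1 k) t≤1) (≤-reflexive (*-identityˡ 1ℚ))

  ^-≤-^suc : ∀ {x} k → 1ℚ ≤ x → x ^ℚ k ≤ x ^ℚ suc k
  ^-≤-^suc {x} k 1≤x = ≤-trans (≤-reflexive (sym (*-identityʳ (x ^ℚ k))))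
    (*-monoˡ-≤-0≤ (0≤^ k (≤-trans (from-yes (0ℚ ≤? 1ℚ)) 1≤x)) 1≤x)

  0≤expTerm : ∀ {q} k → 0ℚ ≤ q → 0ℚ ≤ expTerm q k
  0≤expTerm zero _ = from-yes (0ℚ ≤? 1ℚ)
  0≤expTerm (suc k) 0≤q = 0≤* (0≤* (0≤expTerm k 0≤q) 0≤q) (0≤n/d 1 k)

  expTerm-* : ∀ t x k → expTerm (t * x) k ≡ t ^ℚ k * expTerm x k
  expTerm-* t x zero = sym (*-identityˡ 1ℚ)
  expTerm-* t x (suc k) = trans (cong (λ e → e * (t * x) * (+ 1 / suc k)) (expTerm-* t x k))
    (regroup (t ^ℚ k) (expTerm x k) t x (+ 1 / suc k))
    where
    regroup : ∀ a b t x c → a * b * (t * x) * c ≡ a * t * (b * x * c)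
    regroup = solve 5 (λ a b t x c → a :* b :* (t :* x) :* c := a :* t :* (b :* x :* c)) refl

  module _ {t x : ℚ} (0≤t : 0ℚ ≤ t) (t≤1 : t ≤ 1ℚ) (0≤x : 0ℚ ≤ x) where

    expPartial-convex : ∀ K → expPartial (t * x) K ≤ (1ℚ - t) + t * expPartial x K
    expPartial-convex zero = ≤-trans (≤-reflexive (sym (+-inverseʳ t))) (≤-trans (+-monoˡ-≤ (- t) t≤1)
      (≤-reflexive (identity t)))
      where
      identity : ∀ t → 1ℚ - t ≡ (1ℚ - t) + t * 0ℚ
      identity = solve 1 (λ t → con 1ℚ :- t := (con 1ℚ :- t) :+ t :* con 0ℚ) refl
    expPartial-convex (suc zero) = ≤-reflexive (identity t)
      where
      identity : ∀ t → 0ℚ + 1ℚ ≡ (1ℚ - t) + t * (0ℚ + 1ℚ)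
      identity = solve 1 (λ t → con 0ℚ :+ con 1ℚ := (con 1ℚ :- t) :+ t :* (con 0ℚ :+ con 1ℚ)) refl
    expPartial-convex (suc (suc K)) = begin
      expPartial (t * x) (suc K) + expTerm (t * x) (suc K)   ≤⟨ +-mono-≤ (expPartial-convex (suc K)) term≤ ⟩
      (1ℚ - t) + t * P + t * T                               ≡⟨ regroup (1ℚ - t) t P T ⟩
      (1ℚ - t) + t * (P + T)                                 ∎
      where
      open ≤-Reasoning
      P = expPartial x (suc K)
      T = expTerm x (suc K)
      term≤ : expTerm (t * x) (suc K) ≤ t * T
      term≤ = ≤-trans (≤-reflexive (expTerm-* t x (suc K))) (*-monoʳ-≤-0≤ (0≤expTerm (suc K) 0≤x) (^-≤-base K 0≤t t≤1))
      regroup : ∀ c t p s → c + t * p + t * s ≡ c + t * (p + s)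
      regroup = solve 4 (λ c t p s → c :+ t :* p :+ t :* s := c :+ t :* (p :+ s)) refl

  LeLog⇒LtLog-* : ∀ {t x} n → 0ℚ ≤ t → t < 1ℚ → 0ℚ ≤ x → 2 ℕ.≤ n → LeLog x n → LtLog (t * x) n
  LeLog⇒LtLog-* {t} {x} n 0≤t t<1 0≤x 2≤n e^x≤n =
    (1ℚ - t) + t * N , r<N ,
    λ K → ≤-trans (expPartial-convex 0≤t (<⇒≤ t<1) 0≤x K) (+-monoʳ-≤ (1ℚ - t) (*-monoˡ-≤-0≤ 0≤t (e^x≤n K)))
    where
    N = ℕtoℚ n
    r<N : (1ℚ - t) + t * N < N
    r<N = begin-strict
      (1ℚ - t) + t * N         ≡⟨ cong (_+ t * N) (sym (*-identityʳ (1ℚ - t))) ⟩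
      (1ℚ - t) * 1ℚ + t * N    <⟨ +-monoˡ-< (t * N) (*-monoʳ-<-0< 0<1-t (ℕtoℚ-mono-< 2≤n)) ⟩
      (1ℚ - t) * N + t * N     ≡⟨ identity t N ⟩
      N                        ∎
      where
      open ≤-Reasoning
      0<1-t : 0ℚ < 1ℚ - t
      0<1-t = ≤-<-trans (≤-reflexive (sym (+-inverseʳ t))) (+-monoˡ-< (- t) t<1)
      identity : ∀ t N → (1ℚ - t) * N + t * N ≡ N
      identity = solve 2 (λ t N → (con 1ℚ :- t) :* N :+ t :* N := N) refl

  -- e^q₀ ≈ 2.86 ≤ 3, so q₀ ≤ log n for n ≥ 3; and θ⁴⁸q₀¹³ ≈ 1.16 > 1.
  q₀ : ℚ
  q₀ = + 21 / 20

  θ : ℚ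
  θ = + 99 / 100

  exp-q₀≤3 : ExpLe q₀ (ℕtoℚ 3)
  exp-q₀≤3 zero = from-yes (expPartial q₀ 0 ≤? ℕtoℚ 3)
  exp-q₀≤3 (suc zero) = from-yes (expPartial q₀ 1 ≤? ℕtoℚ 3)
  exp-q₀≤3 (suc (suc zero)) = from-yes (expPartial q₀ 2 ≤? ℕtoℚ 3)
  exp-q₀≤3 (suc (suc (suc K))) = ≤-trans (≤-trans (≤-reflexive (sym (+-identityʳ P₃₊ₖ)))
    (+-monoʳ-≤ P₃₊ₖ (0≤* (from-yes (0ℚ ≤? + 3 / 2)) (0≤expTerm (3 ℕ.+ K) (from-yes (0ℚ ≤? q₀)))))) (tail K)
    where
    P₃₊ₖ = expPartial q₀ (3 ℕ.+ K)
    -- Later terms shrink by the ratio q₀/(k+1) ≤ q₀/4, so the remainder past a term T is at most T/2.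
    tail : ∀ K → expPartial q₀ (3 ℕ.+ K) + (+ 3 / 2) * expTerm q₀ (3 ℕ.+ K) ≤ ℕtoℚ 3
    tail zero = from-yes (expPartial q₀ 3 + (+ 3 / 2) * expTerm q₀ 3 ≤? ℕtoℚ 3)
    tail (suc K) = begin
      P + T + c * (T * q₀ * r)    ≡⟨ regroup P T r ⟩
      P + T * (1ℚ + c * q₀ * r)   ≤⟨ +-monoʳ-≤ P (*-monoˡ-≤-0≤ (0≤expTerm (3 ℕ.+ K) (from-yes (0ℚ ≤? q₀))) ratio≤) ⟩
      P + T * c                   ≡⟨ cong (λ z → P + z) (*-comm T c) ⟩
      P + c * T                   ≤⟨ tail K ⟩
      ℕtoℚ 3                      ∎
      where
      open ≤-Reasoning
      c = + 3 / 2
      P = expPartial q₀ (3 ℕ.+ K)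
      T = expTerm q₀ (3 ℕ.+ K)
      r = + 1 / suc (3 ℕ.+ K)
      r≤1/4 : r ≤ + 1 / 4
      r≤1/4 = fromℚᵘ-mono-≤ {[ + 1 / 3 ℕ.+ K ]ᵘ} {[ + 1 / 3 ]ᵘ} (ℚᵘ.*≤* (ℤ.+≤+ (ℕ.s≤s (ℕ.s≤s (ℕ.s≤s (ℕ.s≤s ℕ.z≤n))))))
      ratio≤ : 1ℚ + c * q₀ * r ≤ c
      ratio≤ = ≤-trans (+-monoʳ-≤ 1ℚ (*-monoˡ-≤-0≤ (from-yes (0ℚ ≤? c * q₀)) r≤1/4)) (from-yes (1ℚ + c * q₀ * (+ 1 / 4) ≤? c))
      regroup : ∀ P T r → P + T + c * (T * q₀ * r) ≡ P + T * (1ℚ + c * q₀ * r)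
      regroup = solve 3 (λ P T r → P :+ T :+ con c :* (T :* con q₀ :* r) := P :+ T :* (con 1ℚ :+ con c :* con q₀ :* r)) refl

  log2<2/a : ∀ k → suc k ℕ.≤ 2 → ¬ LeLog (+ 2 / suc k) 2
  log2<2/a zero _ e^2≤2 = from-no (expPartial (+ 2 / 1) 3 ≤? ℕtoℚ 2) (e^2≤2 3)
  log2<2/a (suc zero) _ e^1≤2 = from-no (expPartial (+ 2 / 2) 3 ≤? ℕtoℚ 2) (e^1≤2 3)
  log2<2/a (suc (suc k)) (ℕ.s≤s (ℕ.s≤s ()))

  M³⁵<[θM]⁴⁸ : ∀ {M} → q₀ ≤ M → M ^ℚ 35 < (θ * M) ^ℚ 48
  M³⁵<[θM]⁴⁸ {M} q₀≤M = begin-strict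
    M ^ℚ 35                      ≡⟨ *-identityˡ _ ⟨
    1ℚ * M ^ℚ 35                 <⟨ *-monoˡ-<-pos (M ^ℚ 35) {{positive (0<^ 35 0<M)}} 1<θ⁴⁸M¹³ ⟩
    θ ^ℚ 48 * M ^ℚ 13 * M ^ℚ 35  ≡⟨ *-assoc (θ ^ℚ 48) (M ^ℚ 13) (M ^ℚ 35) ⟩
    θ ^ℚ 48 * (M ^ℚ 13 * M ^ℚ 35) ≡⟨ cong (θ ^ℚ 48 *_) (^-+ M 13 35) ⟨
    θ ^ℚ 48 * M ^ℚ 48            ≡⟨ ^-distribʳ-* θ M 48 ⟨
    (θ * M) ^ℚ 48                ∎
    where
    open ≤-Reasoning
    0<M : 0ℚ < M
    0<M = <-≤-trans (from-yes (0ℚ <? q₀)) q₀≤M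
    1<θ⁴⁸M¹³ : 1ℚ < θ ^ℚ 48 * M ^ℚ 13
    1<θ⁴⁸M¹³ = <-≤-trans (from-yes (1ℚ <? θ ^ℚ 48 * q₀ ^ℚ 13))
      (*-monoˡ-≤-0≤ (0≤^ 48 (from-yes (0ℚ ≤? θ))) (^-monoˡ-≤ 13 (from-yes (0ℚ ≤? q₀)) q₀≤M))

module CubeWindow where

  open import Defs
  import Data.Nat as ℕ
  import Data.Nat.Properties as ℕ
  open import Data.Nat using (ℕ)
  open import Data.Integer using (+_)
  open import Data.Rational
  open import Data.Rational.Properties
  open import Data.Rational.Solver using (module +-*-Solver)
  open import Data.Product using (_×_; _,_)
  open import Relation.Nullary.Decidable using (from-yes)
  open import Relation.Binary.PropositionalEquality using (_≡_; refl; sym; trans; cong; cong₂; subst₂)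
  open RationalBounds
  open GcdDecomposition using (_≈_×÷_)

  open +-*-Solver

  module _ {N M : ℚ} (0<N : 0ℚ < N) (1≤M : 1ℚ ≤ M) where

    private
      0≤N : 0ℚ ≤ N
      0≤N = <⇒≤ 0<N
      0≤M : 0ℚ ≤ M
      0≤M = ≤-trans (from-yes (0ℚ ≤? 1ℚ)) 1≤M
      0<N*N : 0ℚ < N * N
      0<N*N = 0<* 0<N 0<N

    N≤Y*M³⁵ : ∀ {Y J A B C E} → 0ℚ ≤ Y → 0ℚ ≤ J → 0ℚ ≤ E →
      N ≤ A * M → N ≤ B * M → N ≤ C * M → J ≤ N → E ≤ M ^ℚ 32 →
      A * B * C ≤ Y * (J * J) * E → N ≤ Y * M ^ℚ 35
    N≤Y*M³⁵ {Y} {J} {A} {B} {C} {E} 0≤Y 0≤J 0≤E N≤AM N≤BM N≤CM J≤N E≤M³² ABC≤YJ²E = *-cancelʳ-≤-0< 0<N*N (begin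
      N * (N * N)                    ≤⟨ *-mono-≤-0≤ 0≤N (0≤* 0≤N 0≤N) N≤AM (*-mono-≤-0≤ 0≤N 0≤N N≤BM N≤CM) ⟩
      A * M * (B * M * (C * M))      ≡⟨ regroup₁ A B C M ⟩
      A * B * C * M ^ℚ 3             ≤⟨ *-monoʳ-≤-0≤ (0≤^ 3 0≤M) ABC≤YJ²E ⟩
      Y * (J * J) * E * M ^ℚ 3       ≤⟨ *-monoʳ-≤-0≤ (0≤^ 3 0≤M) (*-mono-≤-0≤ (0≤* 0≤Y (0≤* 0≤J 0≤J)) 0≤E
                                          (*-monoˡ-≤-0≤ 0≤Y (*-mono-≤-0≤ 0≤J 0≤J J≤N J≤N)) E≤M³²) ⟩
      Y * (N * N) * M ^ℚ 32 * M ^ℚ 3 ≡⟨ regroup₂ Y (N * N) (M ^ℚ 32) (M ^ℚ 3) ⟩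
      Y * (M ^ℚ 32 * M ^ℚ 3) * (N * N) ≡⟨ cong (λ P → Y * P * (N * N)) (^-+ M 32 3) ⟨
      Y * M ^ℚ 35 * (N * N)          ∎)
      where
      open ≤-Reasoning
      regroup₁ : ∀ A B C M → A * M * (B * M * (C * M)) ≡ A * B * C * (1ℚ * M * M * M)
      regroup₁ = solve 4 (λ A B C M → A :* M :* (B :* M :* (C :* M)) := A :* B :* C :* (con 1ℚ :* M :* M :* M)) refl
      regroup₂ : ∀ Y S P Q → Y * S * P * Q ≡ Y * (P * Q) * S
      regroup₂ = solve 4 (λ Y S P Q → Y :* S :* P :* Q := Y :* (P :* Q) :* S) refl

    Y≤N*M³⁵ : ∀ {Y J A B C E} → 0ℚ ≤ Y → 0ℚ ≤ A → 0ℚ ≤ B → 0ℚ ≤ C → 0ℚ ≤ E →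
      N ≤ J * M → A ≤ N → B ≤ N → C ≤ N → E ≤ M ^ℚ 32 →
      Y * (J * J) ≤ A * B * C * E → Y ≤ N * M ^ℚ 35
    Y≤N*M³⁵ {Y} {J} {A} {B} {C} {E} 0≤Y 0≤A 0≤B 0≤C 0≤E N≤JM A≤N B≤N C≤N E≤M³² YJ²≤ABCE = *-cancelʳ-≤-0< 0<N*N (begin
      Y * (N * N)                        ≤⟨ *-monoˡ-≤-0≤ 0≤Y (*-mono-≤-0≤ 0≤N 0≤N N≤JM N≤JM) ⟩
      Y * (J * M * (J * M))              ≡⟨ regroup₁ Y J M ⟩
      Y * (J * J) * M ^ℚ 2               ≤⟨ *-monoʳ-≤-0≤ (0≤^ 2 0≤M) YJ²≤ABCE ⟩
      A * B * C * E * M ^ℚ 2             ≤⟨ *-monoʳ-≤-0≤ (0≤^ 2 0≤M) (*-mono-≤-0≤ (0≤* (0≤* 0≤A 0≤B) 0≤C) 0≤E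
                                              (*-mono-≤-0≤ (0≤* 0≤A 0≤B) 0≤C (*-mono-≤-0≤ 0≤A 0≤B A≤N B≤N) C≤N) E≤M³²) ⟩
      N * N * N * M ^ℚ 32 * M ^ℚ 2       ≡⟨ *-assoc (N * N * N) (M ^ℚ 32) (M ^ℚ 2) ⟩
      N * N * N * (M ^ℚ 32 * M ^ℚ 2)     ≡⟨ cong (N * N * N *_) (^-+ M 32 2) ⟨
      N * N * N * M ^ℚ 34                ≤⟨ *-monoˡ-≤-0≤ (0≤* (0≤* 0≤N 0≤N) 0≤N) (^-≤-^suc 34 1≤M) ⟩
      N * N * N * M ^ℚ 35                ≡⟨ regroup₂ N (M ^ℚ 35) ⟩
      N * M ^ℚ 35 * (N * N)              ∎)
      where
      open ≤-Reasoning
      regroup₁ : ∀ Y J M → Y * (J * M * (J * M)) ≡ Y * (J * J) * (1ℚ * M * M)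
      regroup₁ = solve 3 (λ Y J M → Y :* (J :* M :* (J :* M)) := Y :* (J :* J) :* (con 1ℚ :* M :* M)) refl
      regroup₂ : ∀ N P → N * N * N * P ≡ N * P * (N * N)
      regroup₂ = solve 2 (λ N P → N :* N :* N :* P := N :* P :* (N :* N)) refl

  ℕtoℚ-cube*square : ∀ x y → ℕtoℚ (x ℕ.* x ℕ.* x ℕ.* (y ℕ.* y)) ≡ ℕtoℚ x ^ℚ 3 * (ℕtoℚ y * ℕtoℚ y)
  ℕtoℚ-cube*square x y = trans (ℕtoℚ-* (x ℕ.* x ℕ.* x) (y ℕ.* y))
    (cong₂ _*_ (trans (ℕtoℚ-*³ x x x) (cong (λ X → X * ℕtoℚ x * ℕtoℚ x) (sym (*-identityˡ (ℕtoℚ x))))) (ℕtoℚ-* y y))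

  InRange : ℕ → ℚ → ℕ → Set
  InRange n M a = a ℕ.≤ n × ℕtoℚ n ≤ ℕtoℚ a * M

  balanced⇒inWindow : ∀ {n M x j a b c E} → 2 ℕ.≤ n → q₀ ≤ M → LeLog M n →
    InRange n M j → InRange n M a → InRange n M b → InRange n M c → ℕtoℚ E ≤ M ^ℚ 32 → .{{_ : ℕ.NonZero x}} →
    x ℕ.* x ℕ.* x ℕ.* (j ℕ.* j) ≈ a ℕ.* b ℕ.* c ×÷ E → InWindow n (+ x)
  balanced⇒inWindow {n} {M} {x} {j} {a} {b} {c} {E} 2≤n q₀≤M e^M≤n (j≤n , N≤JM) (a≤n , N≤AM) (b≤n , N≤BM) (c≤n , N≤CM) E≤M³²
    (x³j²≤abcE , abc≤x³j²E) =
    0<X , (θ * M , 0<θM , N<Y[θM]⁴⁸ , θM<logn) , (θ * M , 0<θM , Y<N[θM]⁴⁸ , θM<logn)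
    where
    N = ℕtoℚ n
    X = ℕtoℚ x
    Y = X ^ℚ 3
    J = ℕtoℚ j
    A = ℕtoℚ a
    B = ℕtoℚ b
    C = ℕtoℚ c
    0≤θ : 0ℚ ≤ θ
    0≤θ = from-yes (0ℚ ≤? θ)
    0≤M : 0ℚ ≤ M
    0≤M = ≤-trans (from-yes (0ℚ ≤? q₀)) q₀≤M
    1≤M : 1ℚ ≤ M
    1≤M = ≤-trans (from-yes (1ℚ ≤? q₀)) q₀≤M
    0<N : 0ℚ < N
    0<N = ℕtoℚ-mono-< (ℕ.<-≤-trans (ℕ.s≤s ℕ.z≤n) 2≤n)
    0<X : 0ℚ < X
    0<X = ℕtoℚ-mono-< (ℕ.>-nonZero⁻¹ x)
    0<θM : 0ℚ < θ * M
    0<θM = 0<* (from-yes (0ℚ <? θ)) (<-≤-trans (from-yes (0ℚ <? q₀)) q₀≤M)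
    θM<logn : LtLog (θ * M) n
    θM<logn = LeLog⇒LtLog-* n 0≤θ (from-yes (θ <? 1ℚ)) 0≤M 2≤n e^M≤n

    ABC≤YJ²E : A * B * C ≤ Y * (J * J) * ℕtoℚ E
    ABC≤YJ²E = subst₂ _≤_ (ℕtoℚ-*³ a b c)
      (trans (ℕtoℚ-* (x ℕ.* x ℕ.* x ℕ.* (j ℕ.* j)) E) (cong (_* ℕtoℚ E) (ℕtoℚ-cube*square x j))) (ℕtoℚ-mono-≤ abc≤x³j²E)
    YJ²≤ABCE : Y * (J * J) ≤ A * B * C * ℕtoℚ E
    YJ²≤ABCE = subst₂ _≤_ (ℕtoℚ-cube*square x j)
      (trans (ℕtoℚ-* (a ℕ.* b ℕ.* c) E) (cong (_* ℕtoℚ E) (ℕtoℚ-*³ a b c))) (ℕtoℚ-mono-≤ x³j²≤abcE)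

    N<Y[θM]⁴⁸ : N < Y * (θ * M) ^ℚ 48
    N<Y[θM]⁴⁸ = ≤-<-trans
      (N≤Y*M³⁵ 0<N 1≤M {Y} {J} {A} {B} {C} (0≤^ 3 (<⇒≤ 0<X)) (0≤ℕtoℚ j) (0≤ℕtoℚ E)
        N≤AM N≤BM N≤CM (ℕtoℚ-mono-≤ j≤n) E≤M³² ABC≤YJ²E)
      (*-monoʳ-<-0< (0<^ 3 0<X) (M³⁵<[θM]⁴⁸ q₀≤M))
    Y<N[θM]⁴⁸ : Y < N * (θ * M) ^ℚ 48
    Y<N[θM]⁴⁸ = ≤-<-trans
      (Y≤N*M³⁵ 0<N 1≤M {Y} {J} {A} {B} {C} (0≤^ 3 (<⇒≤ 0<X)) (0≤ℕtoℚ a) (0≤ℕtoℚ b) (0≤ℕtoℚ c) (0≤ℕtoℚ E)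
        N≤JM (ℕtoℚ-mono-≤ a≤n) (ℕtoℚ-mono-≤ b≤n) (ℕtoℚ-mono-≤ c≤n) E≤M³² YJ²≤ABCE)
      (*-monoʳ-<-0< 0<N (M³⁵<[θM]⁴⁸ q₀≤M))

module Admissibility where

  open import Defs
  import Data.Nat as ℕ
  import Data.Nat.Properties as ℕ
  open import Data.Nat using (ℕ; suc)
  open import Data.Integer using (+_)
  open import Data.Rational
  open import Data.Rational.Properties
  open import Data.List using (List; []; _∷_; _++_)
  open import Data.List.Relation.Unary.All.Properties using (++⁺)
  open import Data.List.Relation.Unary.All using (All; []; _∷_)
  open import Relation.Binary.Bundles using (DecTotalOrder)
  import Data.List.Extrema (DecTotalOrder.totalOrder ≤-decTotalOrder) as Extrema
  open import Data.Product using (∃; _×_; _,_)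
  open import Data.Sum using (inj₁; inj₂)
  open import Data.Empty using (⊥-elim)
  open import Relation.Binary.PropositionalEquality using (_≡_; refl; sym; trans)
  open PrimeValuation using (SquareDivisor)
  open GcdDecomposition
  open RationalBounds
  open CubeWindow

  record Admissible (n k : ℕ) : Set where
    field
      a≤n : suc k ℕ.≤ n
      n/a≤logn : LeLog (+ n / suc k) n
      square : SquareDivisor (suc k)
      root≤logn : LeLog (ℕtoℚ (SquareDivisor.root square)) n

    scales : List ℚ
    scales = + n / suc k ∷ ℕtoℚ (SquareDivisor.root square) ∷ []

    scales≤logn : All (λ q → LeLog q n) scales
    scales≤logn = n/a≤logn ∷ root≤logn ∷ []

    inRange : ∀ {M} → + n / suc k ≤ M → InRange n M (suc k)
    inRange n/a≤M = a≤n , ≤-trans n≤a*[n/a] (*-monoˡ-≤-0≤ (0≤ℕtoℚ (suc k)) n/a≤M)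
      where
      n≤a*[n/a] : ℕtoℚ n ≤ ℕtoℚ (suc k) * (+ n / suc k)
      n≤a*[n/a] = ≤-reflexive (trans (sym (n/d*d≡n n k)) (*-comm (+ n / suc k) (ℕtoℚ (suc k))))

  common-bound : ∀ {n} → 3 ℕ.≤ n → (qs : List ℚ) → All (λ q → LeLog q n) qs →
    ∃ λ M → q₀ ≤ M × LeLog M n × All (_≤ M) qs
  common-bound {n} 3≤n qs qs≤logn =
    Extrema.max q₀ qs , Extrema.⊥≤max q₀ qs ,
    Extrema.argmax-all (λ q → q) {P = λ q → LeLog q n} (λ K → ≤-trans (exp-q₀≤3 K) (ℕtoℚ-mono-≤ 3≤n)) qs≤logn ,
    Extrema.xs≤max q₀ qs

  open Admissible

  DecompositionInWindow : ℕ → ℕ → Set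
  DecompositionInWindow n a =
    ∃ λ u → ∃ λ v → ∃ λ w → InWindow n (+ u) × InWindow n (+ v) × InWindow n (+ w) × a ≡ u ℕ.* v ℕ.* w

  module _ {n k₁ k₂ k₃ k₄ m : ℕ} (2≤n : 2 ℕ.≤ n)
           (α₁ : Admissible n k₁) (α₂ : Admissible n k₂) (α₃ : Admissible n k₃) (α₄ : Admissible n k₄)
           (a₁a₂a₃a₄≡m³ : suc k₁ ℕ.* suc k₂ ℕ.* suc k₃ ℕ.* suc k₄ ≡ m ℕ.* m ℕ.* m) where

    private
      decomposition-under-bound : ∀ {M} → q₀ ≤ M → LeLog M n →
        All (_≤ M) (scales α₁ ++ scales α₂ ++ scales α₃ ++ scales α₄) → DecompositionInWindow n (suc k₁)
      decomposition-under-bound {M} q₀≤M M≤logn (n/a₁≤M ∷ r₁≤M ∷ n/a₂≤M ∷ r₂≤M ∷ n/a₃≤M ∷ r₃≤M ∷ n/a₄≤M ∷ r₄≤M ∷ []) =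
        u , v , w ,
        balanced⇒inWindow 2≤n q₀≤M M≤logn a₂∈ a₁∈ a₃∈ a₄∈ E≤M³² {{u-nonZero}} u-balanced ,
        balanced⇒inWindow 2≤n q₀≤M M≤logn a₃∈ a₁∈ a₂∈ a₄∈ E≤M³² {{v-nonZero}} v-balanced ,
        balanced⇒inWindow 2≤n q₀≤M M≤logn a₄∈ a₁∈ a₂∈ a₃∈ E≤M³² {{w-nonZero}} w-balanced ,
        a₁≡u*v*w
        where
        open Decomposition (decomposition {m = m} a₁a₂a₃a₄≡m³ (square α₁) (square α₂) (square α₃) (square α₄))
        open SquareDivisor
        a₁∈ : InRange n M (suc k₁)
        a₁∈ = inRange α₁ n/a₁≤M
        a₂∈ : InRange n M (suc k₂)
        a₂∈ = inRange α₂ n/a₂≤M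
        a₃∈ : InRange n M (suc k₃)
        a₃∈ = inRange α₃ n/a₃≤M
        a₄∈ : InRange n M (suc k₄)
        a₄∈ = inRange α₄ n/a₄≤M
        E≤M³² : ℕtoℚ ((root (square α₁) ℕ.* root (square α₂) ℕ.* root (square α₃) ℕ.* root (square α₄)) ℕ.^ 8) ≤ M ^ℚ 32
        E≤M³² = ℕtoℚ-∏⁴-^≤ (root (square α₁)) (root (square α₂)) (root (square α₃)) (root (square α₄)) 8 r₁≤M r₂≤M r₃≤M r₄≤M

    decomposition-in-window : DecompositionInWindow n (suc k₁)
    decomposition-in-window with ℕ.m≤n⇒m<n∨m≡n 2≤n
    ... | inj₂ refl = ⊥-elim (log2<2/a k₁ (a≤n α₁) (n/a≤logn α₁))
    ... | inj₁ 3≤n =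
      let M , q₀≤M , M≤logn , scales≤M = common-bound 3≤n (scales α₁ ++ scales α₂ ++ scales α₃ ++ scales α₄)
            (++⁺ (scales≤logn α₁) (++⁺ (scales≤logn α₂) (++⁺ (scales≤logn α₃) (scales≤logn α₄))))
      in decomposition-under-bound q₀≤M M≤logn scales≤M

open import Defs
open import Data.Nat as ℕ using (ℕ; suc; _≤_)
open import Data.Integer as ℤ using (ℤ; +_; _*_)
open import Data.Integer.Divisibility using (_∣_)
open import Data.Fin using (Fin)
open import Data.Product using (∃; _×_)
open import Relation.Binary.PropositionalEquality using (_≡_)
open import Data.Nat.Divisibility using () renaming (_∣_ to _∣ℕ_)
open import Data.Nat.Tactic.RingSolver using (solve-∀)
import Data.Integer.Properties as ℤ
open import Data.Fin.Patterns using (0F; 1F; 2F; 3F)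
open import Data.Product using (_,_; proj₁; proj₂)
open import Relation.Binary.PropositionalEquality using (sym; trans; cong; cong₂; subst; subst₂; module ≡-Reasoning)
open PrimeValuation using (squareDivisor; module SquareDivisor)
open Admissibility

admissible : ∀ {n a} → NOverLogLe n a × a ℤ.≤ + n → (∀ d → 0 ℕ.< d → (+ d * + d) ∣ a → LeLog (ℕtoℚ d) n) →
  ∃ λ k → a ≡ + suc k × Admissible n k
admissible {n} ((k , a≡ , n/a≤logn) , a≤n) squares≤logn = k , a≡ , record
  { a≤n = ℤ.drop‿+≤+ (subst (ℤ._≤ + n) a≡ a≤n)
  ; n/a≤logn = n/a≤logn
  ; square = s
  ; root≤logn = squares≤logn root (ℕ.>-nonZero⁻¹ root {{root-nonZero}})
      (subst₂ _∣ℕ_ (sym (ℤ.abs-* (+ root) (+ root))) (cong ℤ.∣_∣ (sym a≡)) root²∣x)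
  }
  where
  s = squareDivisor (suc k)
  open SquareDivisor s

in-ℤ : ∀ {n a k} → a ≡ + suc k → DecompositionInWindow n (suc k) →
  ∃ λ u → ∃ λ v → ∃ λ w → InWindow n u × InWindow n v × InWindow n w × a ≡ u * v * w
in-ℤ a≡ (u , v , w , u∈ , v∈ , w∈ , a≡uvw) =
  + u , + v , + w , u∈ , v∈ , w∈ ,
  trans a≡ (trans (cong +_ a≡uvw) (trans (ℤ.pos-* (u ℕ.* v) w) (cong (_* + w) (ℤ.pos-* u v))))

decomposition-in-window-at : ∀ {n m} {k : Fin 4 → ℕ} → 2 ℕ.≤ n → (∀ j → Admissible n (k j)) →
  suc (k 0F) ℕ.* suc (k 1F) ℕ.* suc (k 2F) ℕ.* suc (k 3F) ≡ m ℕ.* m ℕ.* m →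
  ∀ i → DecompositionInWindow n (suc (k i))
decomposition-in-window-at {m = m} {k} 2≤n α ∏≡m³ 0F = decomposition-in-window {m = m} 2≤n (α 0F) (α 1F) (α 2F) (α 3F) ∏≡m³
decomposition-in-window-at {m = m} {k} 2≤n α ∏≡m³ 1F = decomposition-in-window {m = m} 2≤n (α 1F) (α 0F) (α 2F) (α 3F)
  (trans (swap₁ (suc (k 0F)) (suc (k 1F)) (suc (k 2F)) (suc (k 3F))) ∏≡m³)
  where
  swap₁ : ∀ a b c d → b ℕ.* a ℕ.* c ℕ.* d ≡ a ℕ.* b ℕ.* c ℕ.* d
  swap₁ = solve-∀
decomposition-in-window-at {m = m} {k} 2≤n α ∏≡m³ 2F = decomposition-in-window {m = m} 2≤n (α 2F) (α 0F) (α 1F) (α 3F)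
  (trans (swap₂ (suc (k 0F)) (suc (k 1F)) (suc (k 2F)) (suc (k 3F))) ∏≡m³)
  where
  swap₂ : ∀ a b c d → c ℕ.* a ℕ.* b ℕ.* d ≡ a ℕ.* b ℕ.* c ℕ.* d
  swap₂ = solve-∀
decomposition-in-window-at {m = m} {k} 2≤n α ∏≡m³ 3F = decomposition-in-window {m = m} 2≤n (α 3F) (α 0F) (α 1F) (α 2F)
  (trans (swap₃ (suc (k 0F)) (suc (k 1F)) (suc (k 2F)) (suc (k 3F))) ∏≡m³)
  where
  swap₃ : ∀ a b c d → d ℕ.* a ℕ.* b ℕ.* c ≡ a ℕ.* b ℕ.* c ℕ.* d
  swap₃ = solve-∀

∣*³∣ : ∀ x y z → ℤ.∣ x * y * z ∣ ≡ ℤ.∣ x ∣ ℕ.* ℤ.∣ y ∣ ℕ.* ℤ.∣ z ∣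
∣*³∣ x y z = trans (ℤ.abs-* (x * y) z) (cong (ℕ._* ℤ.∣ z ∣) (ℤ.abs-* x y))

∏∣a∣≡∣c∣³ : ∀ {a : Fin 4 → ℤ} {k : Fin 4 → ℕ} {c} → (∀ j → a j ≡ + suc (k j)) →
  a 0F * a 1F * a 2F * a 3F ≡ c * c * c →
  suc (k 0F) ℕ.* suc (k 1F) ℕ.* suc (k 2F) ℕ.* suc (k 3F) ≡ ℤ.∣ c ∣ ℕ.* ℤ.∣ c ∣ ℕ.* ℤ.∣ c ∣
∏∣a∣≡∣c∣³ {a} {k} {c} a≡ ∏a≡c³ = begin
  suc (k 0F) ℕ.* suc (k 1F) ℕ.* suc (k 2F) ℕ.* suc (k 3F) ≡⟨ cong₂ ℕ._*_ (cong₂ ℕ._*_ (cong₂ ℕ._*_ (∣a∣ 0F) (∣a∣ 1F)) (∣a∣ 2F)) (∣a∣ 3F) ⟨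
  ℤ.∣ a 0F ∣ ℕ.* ℤ.∣ a 1F ∣ ℕ.* ℤ.∣ a 2F ∣ ℕ.* ℤ.∣ a 3F ∣ ≡⟨ cong (ℕ._* ℤ.∣ a 3F ∣) (∣*³∣ (a 0F) (a 1F) (a 2F)) ⟨
  ℤ.∣ a 0F * a 1F * a 2F ∣ ℕ.* ℤ.∣ a 3F ∣                ≡⟨ ℤ.abs-* (a 0F * a 1F * a 2F) (a 3F) ⟨
  ℤ.∣ a 0F * a 1F * a 2F * a 3F ∣                        ≡⟨ cong ℤ.∣_∣ ∏a≡c³ ⟩
  ℤ.∣ c * c * c ∣                                        ≡⟨ ∣*³∣ c c c ⟩
  ℤ.∣ c ∣ ℕ.* ℤ.∣ c ∣ ℕ.* ℤ.∣ c ∣                        ∎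
  where
  open ≡-Reasoning
  ∣a∣ : ∀ j → ℤ.∣ a j ∣ ≡ suc (k j)
  ∣a∣ j = cong ℤ.∣_∣ (a≡ j)

lemma8 : (n : ℕ) → 2 ≤ n → (a : Fin 4 → ℤ)
  → (∀ i → NOverLogLe n (a i) × ℤ._≤_ (a i) (+ n))
  → (∀ i → (d : ℕ) → 0 ℕ.< d → (+ d * + d) ∣ a i → LeLog (ℕtoℚ d) n)
  → (∃ λ c → a Fin.zero * a (Fin.suc Fin.zero) * a (Fin.suc (Fin.suc Fin.zero)) * a (Fin.suc (Fin.suc (Fin.suc Fin.zero))) ≡ c * c * c)
  → ∀ i → ∃ λ u → ∃ λ v → ∃ λ w → InWindow n u × InWindow n v × InWindow n w × (a i ≡ u * v * w)
lemma8 n 2≤n a bounds squares (c , ∏a≡c³) i =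
  in-ℤ {n} (a≡ i) (decomposition-in-window-at {n} {ℤ.∣ c ∣} {k} 2≤n α (∏∣a∣≡∣c∣³ {a} {k} {c} a≡ ∏a≡c³) i)
  where
  k : Fin 4 → ℕ
  k j = proj₁ (admissible (bounds j) (squares j))
  a≡ : ∀ j → a j ≡ + suc (k j)
  a≡ j = proj₁ (proj₂ (admissible (bounds j) (squares j)))
  α : ∀ j → Admissible n (k j)
  α j = proj₂ (proj₂ (admissible (bounds j) (squares j)))
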